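{- Let $(\beta_n)_{n\ge2}$ and $(\gamma_n)_{n\ge2}$ be arbitrary sequences of positive integers and $u_1,v_1\in\mathbb Z_{>0}$ arbitrary. Define sequences $(u_n),(v_n)$ by $$u_n=\beta_n\prod_{k=1}^{n-1}u_k,\qquad v_n=\gamma_n\prod_{k=1}^{n-1}v_k,\qquad n\ge2.$$ Define $x_1=u_1$ and $x_j=u_j\prod_{k=1}^{j-1}u_kv_k$ for $j\ge2$. Then $(x_n)$ has the strong Engel property: $z_j=x_j/x_{j-1}^2\in\mathbb Z$ for all $j\ge2$. -}

module Defs where

open import Data.Nat using (ℕ; zero; suc; _*_)

-- Sequences are indexed from 1; the value at index 0 is an unused dummy (1).
mutual
  seqU : ℕ → (ℕ → ℕ) → ℕ → ℕ
  seqU a₁ b zero = 1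
  seqU a₁ b (suc zero) = a₁
  seqU a₁ b (suc (suc n)) = b (suc (suc n)) * prefProd a₁ b (suc n)

  prefProd : ℕ → (ℕ → ℕ) → ℕ → ℕ
  prefProd a₁ b zero = 1
  prefProd a₁ b (suc n) = prefProd a₁ b n * seqU a₁ b (suc n)

prod1 : (ℕ → ℕ) → ℕ → ℕ
prod1 f zero = 1
prod1 f (suc n) = prod1 f n * f (suc n)

xSeq : (u v : ℕ → ℕ) → ℕ → ℕ
xSeq u v zero = 1
xSeq u v (suc zero) = u 1
xSeq u v (suc (suc n)) = u (suc (suc n)) * prod1 (λ k → u k * v k) (suc n)

module Submission where

-- Write U n = u₁ ⋯ uₙ and V n = v₁ ⋯ vₙ for the prefix products
-- (prefProd).  Since the product of the pointwise products uₖvₖ is U·V, the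
-- Engel-type sequence has the closed form
--     x (n+1) = U (n+1) · V n        (n ≥ 0),
-- i.e. x₁ = u₁ and x_{n+2} = u_{n+2} · U (n+1) · V (n+1) = U (n+2) · V (n+1).
-- The defining recursion u_{n+1} = β_{n+1} · U n gives U (n+1) = β_{n+1} · (U n)²
-- for n ≥ 1, so in every case (U n)² divides U (n+1), and likewise for V.
-- Hence x_{n+1}² = (U (n+1))² (V n)² divides U (n+2) · V (n+1) = x_{n+2}.

open import Defs
open import Data.Nat using (ℕ; zero; suc; _*_; _∸_; _≤_; _>_; s≤s)
open import Data.Nat.Properties using (*-assoc; *-comm; *-identityˡ; *-identityʳ; [m*n]*[o*p]≡[m*o]*[n*p])
open import Data.Nat.Divisibility using (_∣_; 1∣_; n∣m*n; *-pres-∣; ∣-refl)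
open import Relation.Binary.PropositionalEquality using (_≡_; refl; cong; cong₂; subst; sym; module ≡-Reasoning)
open ≡-Reasoning

prod1-* : (f g : ℕ → ℕ) (n : ℕ) → prod1 (λ k → f k * g k) n ≡ prod1 f n * prod1 g n
prod1-* f g zero = refl
prod1-* f g (suc n) = begin
  prod1 (λ k → f k * g k) n * (f (suc n) * g (suc n))
    ≡⟨ cong (_* (f (suc n) * g (suc n))) (prod1-* f g n) ⟩
  (prod1 f n * prod1 g n) * (f (suc n) * g (suc n))
    ≡⟨ [m*n]*[o*p]≡[m*o]*[n*p] (prod1 f n) (prod1 g n) (f (suc n)) (g (suc n)) ⟩
  (prod1 f n * f (suc n)) * (prod1 g n * g (suc n)) ∎

prod1-seqU : (a : ℕ) (b : ℕ → ℕ) (n : ℕ) → prod1 (seqU a b) n ≡ prefProd a b n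
prod1-seqU a b zero = refl
prod1-seqU a b (suc n) = cong (_* seqU a b (suc n)) (prod1-seqU a b n)

xSeq-closed : (a c : ℕ) (b d : ℕ → ℕ) (n : ℕ) →
  xSeq (seqU a b) (seqU c d) (suc n) ≡ prefProd a b (suc n) * prefProd c d n
xSeq-closed a c b d zero = begin
  a             ≡⟨ sym (*-identityʳ a) ⟩
  a * 1         ≡⟨ cong (_* 1) (sym (*-identityˡ a)) ⟩
  (1 * a) * 1   ∎
xSeq-closed a c b d (suc n) = begin
  u * prod1 (λ k → seqU a b k * seqU c d k) (suc n)
    ≡⟨ cong (u *_) (prod1-* (seqU a b) (seqU c d) (suc n)) ⟩
  u * (prod1 (seqU a b) (suc n) * prod1 (seqU c d) (suc n))
    ≡⟨ cong (u *_) (cong₂ _*_ (prod1-seqU a b (suc n)) (prod1-seqU c d (suc n))) ⟩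
  u * (U * V)
    ≡⟨ sym (*-assoc u U V) ⟩
  (u * U) * V
    ≡⟨ cong (_* V) (*-comm u U) ⟩
  (U * u) * V ∎
  where
  u U V : ℕ
  u = seqU a b (suc (suc n))
  U = prefProd a b (suc n)
  V = prefProd c d (suc n)

-- The square of a prefix product divides the next one:
-- U (n+1) = U n · (b (n+1) · U n) for n ≥ 1, and U 0 = 1.
prefProd-square-∣ : (a : ℕ) (b : ℕ → ℕ) (n : ℕ) →
  prefProd a b n * prefProd a b n ∣ prefProd a b (suc n)
prefProd-square-∣ a b zero = 1∣ _
prefProd-square-∣ a b (suc n) =
  *-pres-∣ (∣-refl {prefProd a b (suc n)}) (n∣m*n (b (suc (suc n))))

square-product-∣ : ∀ a b {c d} → a * a ∣ c → b * b ∣ d → (a * b) * (a * b) ∣ c * d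
square-product-∣ a b {c} {d} a²∣c b²∣d =
  subst (_∣ c * d) (sym ([m*n]*[o*p]≡[m*o]*[n*p] a b a b)) (*-pres-∣ a²∣c b²∣d)

proposition3p8 : (β γ : ℕ → ℕ) (u₁ v₁ : ℕ) →
    (∀ n → 2 ≤ n → β n > 0) → (∀ n → 2 ≤ n → γ n > 0) → u₁ > 0 → v₁ > 0 →
    ∀ j → 2 ≤ j →
      xSeq (seqU u₁ β) (seqU v₁ γ) (j ∸ 1) * xSeq (seqU u₁ β) (seqU v₁ γ) (j ∸ 1)
        ∣ xSeq (seqU u₁ β) (seqU v₁ γ) j
proposition3p8 β γ u₁ v₁ _ _ _ _ (suc (suc n)) _
  rewrite xSeq-closed u₁ v₁ β γ n | xSeq-closed u₁ v₁ β γ (suc n) =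
  square-product-∣ (prefProd u₁ β (suc n)) (prefProd v₁ γ n)
    (prefProd-square-∣ u₁ β (suc n)) (prefProd-square-∣ v₁ γ n)
proposition3p8 β γ u₁ v₁ _ _ _ _ (suc zero) (s≤s ())
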